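{- Let $G$ be a finite group and let $H$ be a symmetric generating set of $G$ containing $1$. If $H\cdot H\cdot H\neq G$, then $|H\cdot H\cdot H|\geq 2^{1/2}|H|$. -}

module Defs where

open import Data.Nat using (ℕ)
open import Data.Fin using (Fin)
open import Data.Fin.Properties using (any?) renaming (_≟_ to _≟ᶠ_)
open import Data.Fin.Subset using (Subset; _∈_)
open import Data.Fin.Subset.Properties using (_∈?_)
open import Data.Vec using (tabulate)
open import Data.List using (List; foldr)
open import Data.List.Relation.Unary.All using (All)
open import Data.Product using (∃; _×_; _,_)
open import Data.Sum using (_⊎_)
open import Relation.Nullary.Decidable using (⌊_⌋; _×-dec_)
open import Relation.Binary.PropositionalEquality using (_≡_)
open import Algebra.Core using (Op₁; Op₂)

-- A finite group is modelled (up to isomorphism) as a group structure on Fin n,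
-- with propositional equality.

module _ {n : ℕ} where

  setMul : Op₂ (Fin n) → Subset n → Subset n → Subset n
  setMul _∙_ A B = tabulate λ g →
    ⌊ any? (λ a → any? (λ b → (a ∈? A) ×-dec ((b ∈? B) ×-dec ((a ∙ b) ≟ᶠ g)))) ⌋

  Symmetric : Op₁ (Fin n) → Subset n → Set
  Symmetric _⁻¹ H = ∀ x → x ∈ H → (x ⁻¹) ∈ H

  Generates : Op₂ (Fin n) → Fin n → Op₁ (Fin n) → Subset n → Set
  Generates _∙_ ε _⁻¹ H = ∀ g → ∃ λ (xs : List (Fin n)) →
    All (λ x → x ∈ H ⊎ (x ⁻¹) ∈ H) xs × foldr _∙_ ε xs ≡ g

module Submission where

-- If H³ ⊆ H², then H·H² ⊆ H²; since H² contains 1 and H generates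
-- G, this forces H² = G and hence H³ = G.  So some z = abc ∈ H³ (a, b, c ∈ H)
-- lies outside H².  The two maps G × G → G × G
--     shear (x, h) = (h x⁻¹, x)        twist (x, h) = (ab x⁻¹, x c h)
-- are injective, send H × H into H³ × H³, and have disjoint images on H × H:
-- shear (x, h) = twist (x', h') gives abc = h h'⁻¹ ∈ H².  Counting,
-- |H|² + |H|² ≤ |H³|².

open import Defs
open import Level using (0ℓ)
open import Data.Nat using (ℕ; _+_; _*_; _≤_; z≤n; s≤s)
open import Data.Nat.Properties using (*-comm; ≤-reflexive; ≤-trans)
open import Data.Bool using (Bool; true; false; T)
open import Data.Bool.Properties using (T-≡)
open import Data.Fin using (Fin; zero; suc)
open import Data.Fin.Properties using (any?; suc-injective)
open import Data.Fin.Subset using (Subset; _∈_; _∉_; _⊆_; ⊤; ∣_∣)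
open import Data.Fin.Subset.Properties using (_∈?_; ⊆⊤; ⊆-antisym)
open import Data.Vec using (_∷_; []; here; there; tabulate)
open import Data.Vec.Properties using (lookup∘tabulate; []=⇒lookup; lookup⇒[]=)
open import Data.List using (List; []; _∷_; _++_; map; foldr; length; cartesianProduct)
open import Data.List.Properties using (length-map; length-++; length-++-sucʳ)
open import Data.List.Relation.Unary.All using (All; []; _∷_; universal)
import Data.List.Relation.Unary.All as All
open import Data.List.Relation.Unary.Any using (here; there)
open import Data.List.Relation.Unary.Unique.Propositional using (Unique; []; _∷_)
open import Data.List.Relation.Unary.Unique.Propositional.Properties
  using (map⁺; cartesianProduct⁺)
open import Data.List.Membership.Propositional using () renaming (_∈_ to _∈ˡ_)
open import Data.List.Membership.Propositional.Properties
  using (∈-map⁺; ∈-map⁻; ∈-++⁺ˡ; ∈-++⁺ʳ; ∈-++⁻; ∈-∃++; ∈-cartesianProduct⁺; ∈-cartesianProduct⁻)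
import Data.List.Relation.Unary.All.Properties as AllProperties
open import Data.Product using (∃; ∃₂; _×_; _,_; proj₁; proj₂)
open import Data.Product.Properties using (,-injective)
open import Data.Sum using (_⊎_; inj₁; inj₂)
open import Data.Empty using (⊥-elim)
open import Function.Bundles using (Equivalence)
open import Function.Definitions using (Injective)
open import Algebra.Bundles using (Group)
open import Algebra.Core using (Op₁; Op₂)
open import Algebra.Structures using (IsGroup)
open import Relation.Nullary using (yes; no; ¬?)
open import Relation.Nullary.Decidable using (_×-dec_; decidable-stable; toWitness; fromWitness)
open import Relation.Binary.PropositionalEquality
  using (_≡_; _≢_; refl; sym; trans; cong; cong₂; subst; subst₂; module ≡-Reasoning)

InjectiveOn : {A B : Set} → (A → B) → List A → Set
InjectiveOn f xs = ∀ {x y} → x ∈ˡ xs → y ∈ˡ xs → f x ≡ f y → x ≡ y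

-- Pigeonhole for lists: a duplicate-free list injects into ys only if it is
-- no longer than ys.  Remove the image of the head from ys and recurse.
injection⇒length≤ : {A B : Set} (f : A → B) {xs : List A} {ys : List B}
  → Unique xs → InjectiveOn f xs → (∀ {x} → x ∈ˡ xs → f x ∈ˡ ys)
  → length xs ≤ length ys
injection⇒length≤ f {[]} _ _ _ = z≤n
injection⇒length≤ f {x ∷ xs} (x∉xs ∷ unique) inj into with ∈-∃++ (into (here refl))
... | l , r , refl =
  ≤-trans (s≤s (injection⇒length≤ f unique (λ p q → inj (there p) (there q)) into-l++r))
          (≤-reflexive (sym (length-++-sucʳ l (f x) r)))
  where
  -- The tail avoids the head, so by injectivity its image avoids f x.
  into-l++r : ∀ {y} → y ∈ˡ xs → f y ∈ˡ (l ++ r)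
  into-l++r {y} y∈xs with ∈-++⁻ l (into (there y∈xs))
  ... | inj₁ p = ∈-++⁺ˡ p
  ... | inj₂ (here fy≡fx) = ⊥-elim (All.lookup x∉xs y∈xs (sym (inj (there y∈xs) (here refl) fy≡fx)))
  ... | inj₂ (there p) = ∈-++⁺ʳ l p

length-cartesianProduct : {A B : Set} (xs : List A) (ys : List B)
  → length (cartesianProduct xs ys) ≡ length xs * length ys
length-cartesianProduct [] ys = refl
length-cartesianProduct (x ∷ xs) ys = begin
  length (map (x ,_) ys ++ cartesianProduct xs ys)   ≡⟨ length-++ (map (x ,_) ys) ⟩
  length (map (x ,_) ys) + length (cartesianProduct xs ys)
    ≡⟨ cong₂ _+_ (length-map (x ,_) ys) (length-cartesianProduct xs ys) ⟩
  length ys + length xs * length ys                   ∎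
  where open ≡-Reasoning

-- Two injections of a duplicate-free list xs into ys whose images are
-- disjoint give 2|xs| ≤ |ys|: combine them into one injection of xs × Bool.
injections⇒length≤ : {A B : Set} (f g : A → B) {xs : List A} {ys : List B}
  → Unique xs → Injective _≡_ _≡_ f → Injective _≡_ _≡_ g
  → (∀ {x y} → x ∈ˡ xs → y ∈ˡ xs → f x ≢ g y)
  → (∀ {x} → x ∈ˡ xs → f x ∈ˡ ys) → (∀ {x} → x ∈ˡ xs → g x ∈ˡ ys)
  → 2 * length xs ≤ length ys
injections⇒length≤ {A} {B} f g {xs} {ys} unique f-inj g-inj disjoint f-into g-into =
  subst (_≤ length ys) length-tagged (injection⇒length≤ choose tagged-unique choose-inj choose-into)
  where
  tags : List Bool
  tags = true ∷ false ∷ []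

  tagged-unique : Unique (cartesianProduct xs tags)
  tagged-unique = cartesianProduct⁺ unique (((λ ()) ∷ []) ∷ [] ∷ [])

  length-tagged : length (cartesianProduct xs tags) ≡ 2 * length xs
  length-tagged = trans (length-cartesianProduct xs tags) (*-comm (length xs) 2)

  choose : A × Bool → B
  choose (x , true) = f x
  choose (x , false) = g x

  choose-inj : InjectiveOn choose (cartesianProduct xs tags)
  choose-inj {x , true} {y , true} _ _ e = cong (_, true) (f-inj e)
  choose-inj {x , false} {y , false} _ _ e = cong (_, false) (g-inj e)
  choose-inj {x , true} {y , false} p q e =
    ⊥-elim (disjoint (proj₁ (∈-cartesianProduct⁻ xs tags p)) (proj₁ (∈-cartesianProduct⁻ xs tags q)) e)
  choose-inj {x , false} {y , true} p q e =
    ⊥-elim (disjoint (proj₁ (∈-cartesianProduct⁻ xs tags q)) (proj₁ (∈-cartesianProduct⁻ xs tags p)) (sym e))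

  choose-into : ∀ {u} → u ∈ˡ cartesianProduct xs tags → choose u ∈ˡ ys
  choose-into {x , true} p = f-into (proj₁ (∈-cartesianProduct⁻ xs tags p))
  choose-into {x , false} p = g-into (proj₁ (∈-cartesianProduct⁻ xs tags p))

elements : ∀ {n} → Subset n → List (Fin n)
elements [] = []
elements (true ∷ p) = zero ∷ map suc (elements p)
elements (false ∷ p) = map suc (elements p)

length-elements : ∀ {n} (p : Subset n) → length (elements p) ≡ ∣ p ∣
length-elements [] = refl
length-elements (true ∷ p) = cong (1 +_) (trans (length-map suc (elements p)) (length-elements p))
length-elements (false ∷ p) = trans (length-map suc (elements p)) (length-elements p)

∈-elements⁺ : ∀ {n} {x : Fin n} (p : Subset n) → x ∈ p → x ∈ˡ elements p
∈-elements⁺ (true ∷ p) here = here refl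
∈-elements⁺ (true ∷ p) (there x∈p) = there (∈-map⁺ suc (∈-elements⁺ p x∈p))
∈-elements⁺ (false ∷ p) (there x∈p) = ∈-map⁺ suc (∈-elements⁺ p x∈p)

∈-elements⁻ : ∀ {n} {x : Fin n} (p : Subset n) → x ∈ˡ elements p → x ∈ p
∈-elements⁻ (true ∷ p) (here refl) = here
∈-elements⁻ (true ∷ p) (there x∈) with ∈-map⁻ suc x∈
... | _ , y∈ , refl = there (∈-elements⁻ p y∈)
∈-elements⁻ (false ∷ p) x∈ with ∈-map⁻ suc x∈
... | _ , y∈ , refl = there (∈-elements⁻ p y∈)

elements-unique : ∀ {n} (p : Subset n) → Unique (elements p)
elements-unique [] = []
elements-unique (true ∷ p) =
  AllProperties.map⁺ (universal (λ _ ()) (elements p)) ∷ map⁺ suc-injective (elements-unique p)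
elements-unique (false ∷ p) = map⁺ suc-injective (elements-unique p)

_∈×_ : ∀ {a b} → Fin a × Fin b → Subset a × Subset b → Set
u ∈× (A , B) = proj₁ u ∈ A × proj₂ u ∈ B

injections⇒∣∣≤ : ∀ {a b c d} {A : Subset a} {B : Subset b} {C : Subset c} {D : Subset d}
  → (f g : Fin a × Fin b → Fin c × Fin d)
  → Injective _≡_ _≡_ f → Injective _≡_ _≡_ g
  → (∀ {u v} → u ∈× (A , B) → v ∈× (A , B) → f u ≢ g v)
  → (∀ {u} → u ∈× (A , B) → f u ∈× (C , D)) → (∀ {u} → u ∈× (A , B) → g u ∈× (C , D))
  → 2 * (∣ A ∣ * ∣ B ∣) ≤ ∣ C ∣ * ∣ D ∣
injections⇒∣∣≤ {A = A} {B} {C} {D} f g f-inj g-inj disjoint f-into g-into =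
  subst₂ _≤_ (cong (2 *_) (length-pairs A B)) (length-pairs C D)
    (injections⇒length≤ f g (cartesianProduct⁺ (elements-unique A) (elements-unique B))
      f-inj g-inj (λ p q → disjoint (∈-pairs⁻ p) (∈-pairs⁻ q))
      (λ p → ∈-pairs⁺ (f-into (∈-pairs⁻ p))) (λ p → ∈-pairs⁺ (g-into (∈-pairs⁻ p))))
  where
  pairs : ∀ {k m} → Subset k → Subset m → List (Fin k × Fin m)
  pairs P Q = cartesianProduct (elements P) (elements Q)

  length-pairs : ∀ {k m} (P : Subset k) (Q : Subset m) → length (pairs P Q) ≡ ∣ P ∣ * ∣ Q ∣
  length-pairs P Q = trans (length-cartesianProduct (elements P) (elements Q))
                           (cong₂ _*_ (length-elements P) (length-elements Q))

  ∈-pairs⁻ : ∀ {k m} {P : Subset k} {Q : Subset m} {u} → u ∈ˡ pairs P Q → u ∈× (P , Q)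
  ∈-pairs⁻ {P = P} {Q} p with ∈-cartesianProduct⁻ (elements P) (elements Q) p
  ... | x∈ , y∈ = ∈-elements⁻ P x∈ , ∈-elements⁻ Q y∈

  ∈-pairs⁺ : ∀ {k m} {P : Subset k} {Q : Subset m} {u} → u ∈× (P , Q) → u ∈ˡ pairs P Q
  ∈-pairs⁺ {P = P} {Q} (x∈ , y∈) = ∈-cartesianProduct⁺ (∈-elements⁺ P x∈) (∈-elements⁺ Q y∈)

witness-or-⊆ : ∀ {n} (p q : Subset n) → (∃ λ z → z ∈ p × z ∉ q) ⊎ p ⊆ q
witness-or-⊆ p q with any? (λ z → (z ∈? p) ×-dec ¬? (z ∈? q))
... | yes witness = inj₁ witness
... | no none = inj₂ λ {z} z∈p → decidable-stable (z ∈? q) (λ z∉q → none (z , z∈p , z∉q))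

∈-tabulate⁺ : ∀ {n} (F : Fin n → Bool) {g} → T (F g) → g ∈ tabulate F
∈-tabulate⁺ F {g} t = lookup⇒[]= g (tabulate F) (trans (lookup∘tabulate F g) (Equivalence.to T-≡ t))

∈-tabulate⁻ : ∀ {n} (F : Fin n → Bool) {g} → g ∈ tabulate F → T (F g)
∈-tabulate⁻ F {g} g∈ = Equivalence.from T-≡ (trans (sym (lookup∘tabulate F g)) ([]=⇒lookup g∈))

module _ {n : ℕ} (_∙_ : Op₂ (Fin n)) where

  ∈-setMul⁺ : ∀ {A B a b} → a ∈ A → b ∈ B → (a ∙ b) ∈ setMul _∙_ A B
  ∈-setMul⁺ {a = a} {b} a∈A b∈B = ∈-tabulate⁺ _ (fromWitness (a , b , a∈A , b∈B , refl))

  ∈-setMul⁻ : ∀ {A B g} → g ∈ setMul _∙_ A B → ∃₂ λ a b → a ∈ A × b ∈ B × (a ∙ b) ≡ g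
  ∈-setMul⁻ g∈AB = toWitness (∈-tabulate⁻ _ g∈AB)

module _ {n : ℕ} {_∙_ : Op₂ (Fin n)} {ε : Fin n} {_⁻¹ : Op₁ (Fin n)}
         (isGroup : IsGroup _≡_ _∙_ ε _⁻¹) where

  open IsGroup isGroup using (assoc; identityʳ)

  private
    group : Group 0ℓ 0ℓ
    group = record { isGroup = isGroup }

  open import Algebra.Properties.Group group
    using (∙-cancelˡ; ∙-cancelʳ; ⁻¹-injective; ⁻¹-involutive; x≈z//y; //-rightDividesˡ; \\-leftDividesʳ)
  open ≡-Reasoning

  ⊆-setMul-ε : ∀ {A B} → ε ∈ B → A ⊆ setMul _∙_ A B
  ⊆-setMul-ε {A} {B} ε∈B {x} x∈A = subst (_∈ setMul _∙_ A B) (identityʳ x) (∈-setMul⁺ _∙_ x∈A ε∈B)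

  generated⇒everything : ∀ {H S} → Symmetric _⁻¹ H → Generates _∙_ ε _⁻¹ H
    → ε ∈ S → (∀ {h s} → h ∈ H → s ∈ S → (h ∙ s) ∈ S) → ∀ g → g ∈ S
  generated⇒everything {H} {S} symmetric generates ε∈S closed g with generates g
  ... | xs , letters , refl = word∈S xs letters
    where
    letter∈H : ∀ {x} → x ∈ H ⊎ (x ⁻¹) ∈ H → x ∈ H
    letter∈H (inj₁ x∈H) = x∈H
    letter∈H {x} (inj₂ x⁻¹∈H) = subst (_∈ H) (⁻¹-involutive x) (symmetric (x ⁻¹) x⁻¹∈H)

    word∈S : ∀ ys → All (λ y → y ∈ H ⊎ (y ⁻¹) ∈ H) ys → foldr _∙_ ε ys ∈ S
    word∈S [] [] = ε∈S
    word∈S (y ∷ ys) (letter ∷ letters) = closed (letter∈H letter) (word∈S ys letters)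

  -- If H³ ⊆ H² for a symmetric generating set H ∋ ε, then H³ is the whole
  -- group: H² contains ε and absorbs left multiplication by H.
  triple⊆double⇒triple≡⊤ : ∀ {H} → Symmetric _⁻¹ H → Generates _∙_ ε _⁻¹ H → ε ∈ H
    → setMul _∙_ (setMul _∙_ H H) H ⊆ setMul _∙_ H H → setMul _∙_ (setMul _∙_ H H) H ≡ ⊤
  triple⊆double⇒triple≡⊤ {H} symmetric generates ε∈H H³⊆H² =
    ⊆-antisym ⊆⊤ (λ {g} _ → ⊆-setMul-ε ε∈H (generated⇒everything symmetric generates (⊆-setMul-ε ε∈H ε∈H) absorbs g))
    where
    absorbs : ∀ {h s} → h ∈ H → s ∈ setMul _∙_ H H → (h ∙ s) ∈ setMul _∙_ H H
    absorbs {h} h∈H s∈H² with ∈-setMul⁻ _∙_ s∈H²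
    ... | a , b , a∈H , b∈H , refl =
      H³⊆H² (subst (_∈ setMul _∙_ (setMul _∙_ H H) H) (assoc h a b)
                   (∈-setMul⁺ _∙_ (∈-setMul⁺ _∙_ h∈H a∈H) b∈H))

  shear : Fin n × Fin n → Fin n × Fin n
  shear (x , h) = (h ∙ (x ⁻¹) , x)

  twist : Fin n → Fin n → Fin n × Fin n → Fin n × Fin n
  twist u c (x , h) = (u ∙ (x ⁻¹) , x ∙ (c ∙ h))

  shear-injective : Injective _≡_ _≡_ shear
  shear-injective {x , h} {x′ , h′} e with ,-injective e
  ... | e₁ , refl = cong (x ,_) (∙-cancelʳ (x ⁻¹) h h′ e₁)

  twist-injective : ∀ u c → Injective _≡_ _≡_ (twist u c)
  twist-injective u c {x , h} {x′ , h′} e with ,-injective e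
  ... | e₁ , e₂ with ⁻¹-injective (∙-cancelˡ u (x ⁻¹) (x′ ⁻¹) e₁)
  ...   | refl = cong (x ,_) (∙-cancelˡ c h h′ (∙-cancelˡ x (c ∙ h) (c ∙ h′) e₂))

  shear≡twist⇒ : ∀ {u c x h x′ h′} → shear (x , h) ≡ twist u c (x′ , h′) → (u ∙ c) ≡ (h ∙ (h′ ⁻¹))
  shear≡twist⇒ {u} {c} {x} {h} {x′} {h′} e with ,-injective e
  ... | e₁ , e₂ = x≈z//y (u ∙ c) h′ h (sym h≡uch′)
    where
    h≡uch′ : h ≡ ((u ∙ c) ∙ h′)
    h≡uch′ = begin
      h                                  ≡⟨ //-rightDividesˡ x h ⟨
      (h ∙ (x ⁻¹)) ∙ x                   ≡⟨ cong₂ _∙_ e₁ e₂ ⟩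
      (u ∙ (x′ ⁻¹)) ∙ (x′ ∙ (c ∙ h′))    ≡⟨ assoc u (x′ ⁻¹) (x′ ∙ (c ∙ h′)) ⟩
      u ∙ ((x′ ⁻¹) ∙ (x′ ∙ (c ∙ h′)))    ≡⟨ cong (u ∙_) (\\-leftDividesʳ x′ (c ∙ h′)) ⟩
      u ∙ (c ∙ h′)                       ≡⟨ assoc u c h′ ⟨
      (u ∙ c) ∙ h′                       ∎

  escape⇒bound : ∀ {H z} → Symmetric _⁻¹ H → ε ∈ H
    → z ∈ setMul _∙_ (setMul _∙_ H H) H → z ∉ setMul _∙_ H H
    → 2 * (∣ H ∣ * ∣ H ∣) ≤ ∣ setMul _∙_ (setMul _∙_ H H) H ∣ * ∣ setMul _∙_ (setMul _∙_ H H) H ∣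
  escape⇒bound {H} symmetric ε∈H z∈H³ z∉H² with ∈-setMul⁻ _∙_ z∈H³
  ... | p , c , p∈H² , c∈H , refl with ∈-setMul⁻ _∙_ p∈H²
  ... | a , b , a∈H , b∈H , refl =
    injections⇒∣∣≤ shear (twist (a ∙ b) c) shear-injective (twist-injective (a ∙ b) c)
      disjoint shear-into twist-into
    where
    H² = setMul _∙_ H H
    H³ = setMul _∙_ H² H

    disjoint : ∀ {u v} → u ∈× (H , H) → v ∈× (H , H) → shear u ≢ twist (a ∙ b) c v
    disjoint {x , h} {x′ , h′} (_ , h∈H) (_ , h′∈H) e =
      z∉H² (subst (_∈ H²) (sym (shear≡twist⇒ e)) (∈-setMul⁺ _∙_ h∈H (symmetric h′ h′∈H)))

    shear-into : ∀ {u} → u ∈× (H , H) → shear u ∈× (H³ , H³)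
    shear-into {x , h} (x∈H , h∈H) =
        ⊆-setMul-ε ε∈H (∈-setMul⁺ _∙_ h∈H (symmetric x x∈H))
      , ⊆-setMul-ε ε∈H (⊆-setMul-ε ε∈H x∈H)

    twist-into : ∀ {u} → u ∈× (H , H) → twist (a ∙ b) c u ∈× (H³ , H³)
    twist-into {x , h} (x∈H , h∈H) =
        ∈-setMul⁺ _∙_ (∈-setMul⁺ _∙_ a∈H b∈H) (symmetric x x∈H)
      , subst (_∈ H³) (assoc x c h) (∈-setMul⁺ _∙_ (∈-setMul⁺ _∙_ x∈H c∈H) h∈H)

lemma3p2 : (n : ℕ) (_∙_ : Op₂ (Fin n)) (ε : Fin n) (_⁻¹ : Op₁ (Fin n))
    → IsGroup _≡_ _∙_ ε _⁻¹
    → (H : Subset n)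
    → Symmetric _⁻¹ H
    → Generates _∙_ ε _⁻¹ H
    → ε ∈ H
    → setMul _∙_ (setMul _∙_ H H) H ≢ ⊤
    → 2 * (∣ H ∣ * ∣ H ∣) ≤ ∣ setMul _∙_ (setMul _∙_ H H) H ∣ * ∣ setMul _∙_ (setMul _∙_ H H) H ∣
lemma3p2 n _∙_ ε _⁻¹ isGroup H symmetric generates ε∈H H³≢⊤
  with witness-or-⊆ (setMul _∙_ (setMul _∙_ H H) H) (setMul _∙_ H H)
... | inj₁ (z , z∈H³ , z∉H²) = escape⇒bound isGroup symmetric ε∈H z∈H³ z∉H²
... | inj₂ H³⊆H² = ⊥-elim (H³≢⊤ (triple⊆double⇒triple≡⊤ isGroup symmetric generates ε∈H H³⊆H²))
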